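{- Let $\mathbf{C}$ be an even snowflake with $M$ edges whose center $z$ has odd degree. If $M\equiv 0\pmod 4$, then $\mathbf{C}$ admits a conservative labeling; otherwise $\mathbf{C}$ admits a near-conservative labeling.
   Context: A snowflake is the tree obtained from a disjoint union of stars $S_1,\ldots,S_p$ ($S_i\cong K_{1,n_i}$, $n_i\geq 3$) by identifying one leaf of each star into a single vertex $z$, the center. An internal vertex is a vertex of degree at least $2$. A snowflake is even if every internal vertex other than possibly the center has even degree. A labeling is a bijection from the edge set to a set of positive integers of the same size; $[a,b]=\{a,\ldots,b\}$. Given an orientation and labeling $\phi$, the vertex-sum $s(u)$ is the sum of labels of arcs entering $u$ minus the sum of labels of arcs leaving $u$. For a graph with $M$ edges, a conservative labeling is an (orientation, labeling) pair with label set $[1,M]$ and $s(u)=0$ at every vertex of degree at least $3$; a near-conservative labeling is the same with label set $[1,M-1]\cup\{M+1\}$. -}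

module Defs where

open import Data.Nat using (ℕ; zero; suc; _≤_; _∸_; _<_)
open import Data.Fin using (Fin)
import Data.Fin.Properties as FinP
open import Data.Integer using (ℤ; +_; _+_; _-_; 0ℤ)
open import Data.Bool using (Bool; true; false; if_then_else_)
open import Data.Product using (_×_; _,_; proj₁; proj₂; ∃)
open import Data.Sum using (_⊎_)
open import Data.List using (List; []; _∷_; map; concatMap; length; lookup; allFin; tabulate; foldr)
open import Relation.Binary.PropositionalEquality using (_≡_; refl; cong)
open import Relation.Binary.Definitions using (DecidableEquality)
open import Relation.Nullary using (Dec; yes; no; ¬_; does)

record Graph : Set₁ where
  field
    V     : Set
    _≟V_  : DecidableEquality V
    m     : ℕ
    ends  : Fin m → V × V

module _ (G : Graph) where
  open Graph G

  sumℕ : List ℕ → ℕ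
  sumℕ = foldr Data.Nat._+_ 0

  sumℤ : List ℤ → ℤ
  sumℤ = foldr _+_ 0ℤ

  ind : Bool → ℕ
  ind true  = 1
  ind false = 0

  -- number of edges incident to u (a loop would count twice; none occur below)
  degree : V → ℕ
  degree u = sumℕ (tabulate λ e →
    Data.Nat._+_ (ind (does (proj₁ (ends e) ≟V u))) (ind (does (proj₂ (ends e) ≟V u))))

  -- An orientation: true = arc from proj₁ (ends e) to proj₂ (ends e), false = reversed.
  Orientation : Set
  Orientation = Fin m → Bool

  tail head : Orientation → Fin m → V
  tail o e = if o e then proj₁ (ends e) else proj₂ (ends e)
  head o e = if o e then proj₂ (ends e) else proj₁ (ends e)

  record IsLabeling (L : ℕ → Set) (φ : Fin m → ℕ) : Set where
    field
      into   : ∀ e → L (φ e)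
      inj    : ∀ e f → φ e ≡ φ f → e ≡ f
      onto   : ∀ l → L l → ∃ λ e → φ e ≡ l

  vsum : Orientation → (Fin m → ℕ) → V → ℤ
  vsum o φ u = sumℤ (tabulate λ e →
    (if does (head o e ≟V u) then + φ e else 0ℤ) - (if does (tail o e ≟V u) then + φ e else 0ℤ))

  ZeroSumLabeling : (ℕ → Set) → Set
  ZeroSumLabeling L = ∃ λ (o : Orientation) → ∃ λ (φ : Fin m → ℕ) →
    IsLabeling L φ × (∀ u → 3 ≤ degree u → vsum o φ u ≡ 0ℤ)

  Conservative : Set
  Conservative = ZeroSumLabeling (λ l → 1 ≤ l × l ≤ m)

  NearConservative : Set
  NearConservative = ZeroSumLabeling (λ l → (1 ≤ l × l ≤ m ∸ 1) ⊎ l ≡ suc m)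

-- Stars S_i ≅ K_{1, n i} (i : Fin p) with centers hub i;
-- one leaf of each star is identified with the center cen; the remaining
-- n i - 1 leaves of S_i are leaf i k, k : Fin (n i ∸ 1).

data SV (p : ℕ) (n : Fin p → ℕ) : Set where
  cen  : SV p n
  hub  : Fin p → SV p n
  leaf : (i : Fin p) → Fin (n i ∸ 1) → SV p n

module _ {p : ℕ} {n : Fin p → ℕ} where
  _≟SV_ : DecidableEquality (SV p n)
  cen ≟SV cen = yes refl
  cen ≟SV hub _ = no λ ()
  cen ≟SV leaf _ _ = no λ ()
  hub _ ≟SV cen = no λ ()
  hub i ≟SV hub j with i FinP.≟ j
  ... | yes refl = yes refl
  ... | no ne = no λ { refl → ne refl }
  hub _ ≟SV leaf _ _ = no λ ()
  leaf _ _ ≟SV cen = no λ ()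
  leaf _ _ ≟SV hub _ = no λ ()
  leaf i k ≟SV leaf j l with i FinP.≟ j
  ... | no ne = no λ { refl → ne refl }
  ... | yes refl with k FinP.≟ l
  ...   | yes refl = yes refl
  ...   | no ne = no λ { refl → ne refl }

snowEdges : (p : ℕ) (n : Fin p → ℕ) → List (SV p n × SV p n)
snowEdges p n = concatMap (λ i → (cen , hub i) ∷ map (λ k → (hub i , leaf i k)) (allFin (n i ∸ 1))) (allFin p)

snowflake : (p : ℕ) (n : Fin p → ℕ) → Graph
snowflake p n = record
  { V = SV p n ; _≟V_ = _≟SV_ ; m = length (snowEdges p n) ; ends = lookup (snowEdges p n) }

-- Number the M edges 0, 1, …, M − 1 star by star and give position x the label 1 + swap₁₂ x,
-- where swap₁₂ exchanges 4u + 1 and 4u + 2: the labels used are then [1, M] if 4 ∣ M, and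
-- [1, M − 1] ∪ {M + 1} if M ≡ 2 (mod 4).  Every star has an even number of edges, so it occupies
-- a segment of even length starting at an even position, and the labels of such a segment can be
-- signed so that they sum to zero (+ − − + on each aligned block of four, after one of two
-- six-term patterns when the length is 2 mod 4).  Orienting the edges of a star by these signs, or
-- by the opposite ones, balances its hub, and the position of the centre edge within the segment
-- is free.  The centre has odd degree 2q + 1: stars 2t + 1 and 2t + 2 put their centre edges on
-- the two adjacent positions where star 2t + 2 begins, whose labels differ by one, so each pair
-- contributes ± 1 with a sign of our choice; star 0 puts its centre edge on label 1 or 2 to
-- cancel the q pair contributions + + − + − ….

module Submission where

open import Algebra.Core using (Op₂)
import Algebra.Structures as Structures
open import Data.Bool using (Bool; true; false; if_then_else_; not; _xor_; _∨_)
import Data.Bool.Properties as BoolP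
open import Data.Empty using (⊥-elim)
open import Data.Fin as Fin using (Fin; toℕ)
import Data.Fin.Properties as FinP
open import Data.Integer as ℤ using (ℤ; +_; -_; 0ℤ)
import Data.Integer.Properties as ℤP
open import Data.Integer.Tactic.RingSolver using (solve-∀)
open import Data.List using (List; []; _∷_; _++_; map; concatMap; foldr; tabulate; allFin; lookup; length)
import Data.List.Properties as ListP
open import Data.List.Membership.Propositional using (_∈_)
open import Data.List.Membership.Propositional.Properties using (∈-concatMap⁺; ∈-concatMap⁻; ∈-map⁺; ∈-map⁻; ∈-allFin; ∈-lookup)
open import Data.List.Relation.Unary.Any as Any using (here; there)
import Data.List.Relation.Unary.Any.Properties as AnyP
open import Data.Nat as ℕ using (ℕ; zero; suc; _+_; _∸_; _<_; _≤_; _*_; z≤n; s≤s; _≡ᵇ_)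
open import Data.Nat.Divisibility using (_∣_; divides; ∣m+n∣m⇒∣n; ∣m∣n⇒∣m+n)
import Data.Nat.Properties as ℕP
open import Data.Product using (_×_; _,_; proj₁; proj₂; ∃)
open import Data.Sum using (_⊎_; inj₁; inj₂)
open import Function using (_∘_; Equivalence)
open import Relation.Binary.Definitions using (DecidableEquality)
open import Relation.Binary.PropositionalEquality
open import Relation.Nullary using (yes; no; ¬_; does)
open import Relation.Nullary.Decidable using (dec-true; dec-false)

open import Defs

transpose₀ : ℕ → ℕ → ℕ
transpose₀ r zero    = r
transpose₀ r (suc x) = if suc x ≡ᵇ r then 0 else suc x

transpose₀-involutive : ∀ r x → transpose₀ r (transpose₀ r x) ≡ x
transpose₀-involutive zero    zero    = refl
transpose₀-involutive (suc r) zero    rewrite Equivalence.to BoolP.T-≡ (ℕP.≡⇒≡ᵇ r r refl) = refl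
transpose₀-involutive r       (suc x) with suc x ≡ᵇ r in eq
... | true  = sym (ℕP.≡ᵇ⇒≡ (suc x) r (Equivalence.from BoolP.T-≡ eq))
... | false rewrite eq = refl

transpose₀-< : ∀ {N} r x → r < N → x < N → transpose₀ r x < N
transpose₀-< r zero    r<N x<N = r<N
transpose₀-< r (suc x) r<N x<N with suc x ≡ᵇ r
... | true  = ℕP.≤-trans (s≤s z≤n) x<N
... | false = x<N

module Summation {A : Set} {_∙_ : Op₂ A} {ε : A}
  (isCommutativeMonoid : Structures.IsCommutativeMonoid {A = A} _≡_ _∙_ ε) where

  open Structures.IsCommutativeMonoid isCommutativeMonoid using (assoc; comm; identityˡ; identityʳ)
  open ≡-Reasoning

  Σ : List A → A
  Σ = foldr _∙_ ε

  Σ-++ : ∀ xs ys → Σ (xs ++ ys) ≡ Σ xs ∙ Σ ys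
  Σ-++ []       ys = sym (identityˡ (Σ ys))
  Σ-++ (x ∷ xs) ys = trans (cong (x ∙_) (Σ-++ xs ys)) (sym (assoc x (Σ xs) (Σ ys)))

  Σ-map-concatMap : ∀ {B C : Set} (f : C → A) (g : B → List C) xs →
                    Σ (map f (concatMap g xs)) ≡ Σ (map (λ x → Σ (map f (g x))) xs)
  Σ-map-concatMap f g []       = refl
  Σ-map-concatMap f g (x ∷ xs) = begin
    Σ (map f (g x ++ concatMap g xs))            ≡⟨ cong Σ (ListP.map-++ f (g x) (concatMap g xs)) ⟩
    Σ (map f (g x) ++ map f (concatMap g xs))    ≡⟨ Σ-++ (map f (g x)) _ ⟩
    Σ (map f (g x)) ∙ Σ (map f (concatMap g xs)) ≡⟨ cong (_ ∙_) (Σ-map-concatMap f g xs) ⟩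
    Σ (map f (g x)) ∙ Σ (map (λ x → Σ (map f (g x))) xs) ∎

  Σ-map-ε : ∀ {B : Set} (f : B → A) → (∀ x → f x ≡ ε) → ∀ xs → Σ (map f xs) ≡ ε
  Σ-map-ε f f≡ε []       = refl
  Σ-map-ε f f≡ε (x ∷ xs) = trans (cong₂ _∙_ (f≡ε x) (Σ-map-ε f f≡ε xs)) (identityˡ ε)

  Σ-tabulate-single : ∀ {N} (f : Fin N → A) i → (∀ j → j ≢ i → f j ≡ ε) → Σ (tabulate f) ≡ f i
  Σ-tabulate-single f Fin.zero f≡ε = begin
    f Fin.zero ∙ Σ (tabulate (f ∘ Fin.suc))                ≡⟨ cong (f Fin.zero ∙_) (cong Σ (sym (ListP.map-tabulate (λ j → j) (f ∘ Fin.suc)))) ⟩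
    f Fin.zero ∙ Σ (map (f ∘ Fin.suc) (allFin _))          ≡⟨ cong (f Fin.zero ∙_) (Σ-map-ε (f ∘ Fin.suc) (λ j → f≡ε (Fin.suc j) λ ()) (allFin _)) ⟩
    f Fin.zero ∙ ε                                         ≡⟨ identityʳ _ ⟩
    f Fin.zero ∎
  Σ-tabulate-single f (Fin.suc i) f≡ε =
    trans (cong₂ _∙_ (f≡ε Fin.zero λ ()) (Σ-tabulate-single (f ∘ Fin.suc) i λ j j≢i → f≡ε (Fin.suc j) (j≢i ∘ FinP.suc-injective)))
          (identityˡ _)

  Σ-allFin-single : ∀ {N} (f : Fin N → A) i → (∀ j → j ≢ i → f j ≡ ε) → Σ (map f (allFin N)) ≡ f i
  Σ-allFin-single f i f≡ε = trans (cong Σ (ListP.map-tabulate (λ j → j) f)) (Σ-tabulate-single f i f≡ε)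

  sumBelow : ℕ → (ℕ → A) → A
  sumBelow zero    h = ε
  sumBelow (suc N) h = h 0 ∙ sumBelow N (h ∘ suc)

  Σ-tabulate : ∀ {N} (f : Fin N → A) (h : ℕ → A) → (∀ i → f i ≡ h (toℕ i)) → Σ (tabulate f) ≡ sumBelow N h
  Σ-tabulate {zero}  f h f≡h = refl
  Σ-tabulate {suc N} f h f≡h = cong₂ _∙_ (f≡h Fin.zero) (Σ-tabulate (f ∘ Fin.suc) (h ∘ suc) (f≡h ∘ Fin.suc))

  Σ-allFin : ∀ {N} (f : Fin N → A) (h : ℕ → A) → (∀ i → f i ≡ h (toℕ i)) → Σ (map f (allFin N)) ≡ sumBelow N h
  Σ-allFin f h f≡h = trans (cong Σ (ListP.map-tabulate (λ j → j) f)) (Σ-tabulate f h f≡h)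

  sumBelow-cong : ∀ N {g h : ℕ → A} → (∀ x → g x ≡ h x) → sumBelow N g ≡ sumBelow N h
  sumBelow-cong zero    g≡h = refl
  sumBelow-cong (suc N) g≡h = cong₂ _∙_ (g≡h 0) (sumBelow-cong N (g≡h ∘ suc))

  sumBelow-cong< : ∀ N {g h : ℕ → A} → (∀ x → x < N → g x ≡ h x) → sumBelow N g ≡ sumBelow N h
  sumBelow-cong< zero    g≡h = refl
  sumBelow-cong< (suc N) g≡h = cong₂ _∙_ (g≡h 0 (s≤s z≤n)) (sumBelow-cong< N λ x x<N → g≡h (suc x) (s≤s x<N))

  sumBelow-suc : ∀ N h → sumBelow (suc N) h ≡ sumBelow N h ∙ h N
  sumBelow-suc zero    h = trans (identityʳ (h 0)) (sym (identityˡ (h 0)))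
  sumBelow-suc (suc N) h = trans (cong (h 0 ∙_) (sumBelow-suc N (h ∘ suc))) (sym (assoc (h 0) _ _))

  sumBelow-+ : ∀ M N h → sumBelow (M + N) h ≡ sumBelow M h ∙ sumBelow N (λ x → h (M + x))
  sumBelow-+ zero    N h = sym (identityˡ _)
  sumBelow-+ (suc M) N h = trans (cong (h 0 ∙_) (sumBelow-+ M N (h ∘ suc))) (sym (assoc (h 0) _ _))

  sumBelow-pairs : ∀ q h → sumBelow (q * 2) h ≡ sumBelow q (λ t → h (t * 2) ∙ h (suc (t * 2)))
  sumBelow-pairs zero    h = refl
  sumBelow-pairs (suc q) h = trans (sym (assoc (h 0) (h 1) _)) (cong (_ ∙_) (sumBelow-pairs q (h ∘ suc ∘ suc)))

  update : ℕ → A → (ℕ → A) → ℕ → A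
  update r a h x = if x ≡ᵇ r then a else h x

  sumBelow-update : ∀ N r a h → r < N → sumBelow N (update r a h) ∙ h r ≡ sumBelow N h ∙ a
  sumBelow-update (suc N) zero a h _ = begin
    (a ∙ R) ∙ h 0     ≡⟨ comm (a ∙ R) (h 0) ⟩
    h 0 ∙ (a ∙ R)     ≡⟨ cong (h 0 ∙_) (comm a R) ⟩
    h 0 ∙ (R ∙ a)     ≡⟨ sym (assoc (h 0) R a) ⟩
    (h 0 ∙ R) ∙ a     ∎
    where R = sumBelow N (h ∘ suc)
  sumBelow-update (suc N) (suc r) a h (s≤s r<N) = begin
    (h 0 ∙ R′) ∙ h (suc r)                  ≡⟨ assoc (h 0) R′ _ ⟩
    h 0 ∙ (R′ ∙ h (suc r))                  ≡⟨ cong (h 0 ∙_) (sumBelow-update N r a (h ∘ suc) r<N) ⟩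
    h 0 ∙ (sumBelow N (h ∘ suc) ∙ a)        ≡⟨ sym (assoc (h 0) _ a) ⟩
    (h 0 ∙ sumBelow N (h ∘ suc)) ∙ a        ∎
    where R′ = sumBelow N (update r a (h ∘ suc))

  sumBelow-transpose₀ : ∀ N r h → r < N → sumBelow N (h ∘ transpose₀ r) ≡ sumBelow N h
  sumBelow-transpose₀ N zero h _ = sumBelow-cong N fixed
    where
    fixed : ∀ x → h (transpose₀ 0 x) ≡ h x
    fixed zero    = refl
    fixed (suc x) = refl
  sumBelow-transpose₀ (suc N) (suc r) h (s≤s r<N) = begin
    h (suc r) ∙ sumBelow N (h ∘ transpose₀ (suc r) ∘ suc)  ≡⟨ cong (h (suc r) ∙_) (sumBelow-cong N λ x → BoolP.if-float h (x ≡ᵇ r)) ⟩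
    h (suc r) ∙ sumBelow N (update r (h 0) (h ∘ suc))      ≡⟨ comm (h (suc r)) _ ⟩
    sumBelow N (update r (h 0) (h ∘ suc)) ∙ h (suc r)      ≡⟨ sumBelow-update N r (h 0) (h ∘ suc) r<N ⟩
    sumBelow N (h ∘ suc) ∙ h 0                             ≡⟨ comm _ (h 0) ⟩
    h 0 ∙ sumBelow N (h ∘ suc)                             ∎

module ℕSum = Summation ℕP.+-0-isCommutativeMonoid
module ℤSum = Summation ℤP.+-0-isCommutativeMonoid
open ℤSum using (sumBelow; sumBelow-cong)

swap₁₂ : ℕ → ℕ
swap₁₂ 0 = 0
swap₁₂ 1 = 2
swap₁₂ 2 = 1
swap₁₂ 3 = 3
swap₁₂ (suc (suc (suc (suc x)))) = 4 + swap₁₂ x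

swap₁₂-involutive : ∀ x → swap₁₂ (swap₁₂ x) ≡ x
swap₁₂-involutive 0 = refl
swap₁₂-involutive 1 = refl
swap₁₂-involutive 2 = refl
swap₁₂-involutive 3 = refl
swap₁₂-involutive (suc (suc (suc (suc x)))) = cong (λ y → 4 + y) (swap₁₂-involutive x)

swap₁₂-injective : ∀ x y → swap₁₂ x ≡ swap₁₂ y → x ≡ y
swap₁₂-injective x y eq = trans (sym (swap₁₂-involutive x)) (trans (cong swap₁₂ eq) (swap₁₂-involutive y))

swap₁₂-+ : ∀ u x → swap₁₂ (u * 4 + x) ≡ u * 4 + swap₁₂ x
swap₁₂-+ zero    x = refl
swap₁₂-+ (suc u) x = cong (λ y → 4 + y) (swap₁₂-+ u x)

swap₁₂-four* : ∀ u → swap₁₂ (u * 4) ≡ u * 4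
swap₁₂-four* zero    = refl
swap₁₂-four* (suc u) = cong (λ y → 4 + y) (swap₁₂-four* u)

swap₁₂-four*+1 : ∀ u → swap₁₂ (suc (u * 4)) ≡ 2 + u * 4
swap₁₂-four*+1 zero    = refl
swap₁₂-four*+1 (suc u) = cong (λ y → 4 + y) (swap₁₂-four*+1 u)

swap₁₂-< : ∀ u x → x < u * 4 → swap₁₂ x < u * 4
swap₁₂-< (suc u) 0 _ = s≤s z≤n
swap₁₂-< (suc u) 1 _ = s≤s (s≤s (s≤s z≤n))
swap₁₂-< (suc u) 2 _ = s≤s (s≤s z≤n)
swap₁₂-< (suc u) 3 _ = s≤s (s≤s (s≤s (s≤s z≤n)))
swap₁₂-< (suc u) (suc (suc (suc (suc x)))) (s≤s (s≤s (s≤s (s≤s x<)))) = s≤s (s≤s (s≤s (s≤s (swap₁₂-< u x x<))))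

swap₁₂-2+ : ∀ u x → swap₁₂ (2 + u * 4 + x) ≡ u * 4 + swap₁₂ (2 + x)
swap₁₂-2+ u x = trans (cong swap₁₂ (sym (trans (ℕP.+-suc (u * 4) (suc x)) (cong suc (ℕP.+-suc (u * 4) x))))) (swap₁₂-+ u (2 + x))

swap₁₂-c+ : ∀ c u → swap₁₂ (c + u * 4) ≡ u * 4 + swap₁₂ c
swap₁₂-c+ c u = trans (cong swap₁₂ (ℕP.+-comm c (u * 4))) (swap₁₂-+ u c)

label : ℕ → ℕ
label x = suc (swap₁₂ x)

data EvenForm : ℕ → Set where
  four*_   : ∀ u → EvenForm (u * 4)
  2+four*_ : ∀ u → EvenForm (2 + u * 4)

evenForm : ∀ {a} → 2 ∣ a → EvenForm a
evenForm {0} _ = four* 0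
evenForm {1} (divides zero ())
evenForm {1} (divides (suc _) ())
evenForm {2} _ = 2+four* 0
evenForm {3} (divides zero ())
evenForm {3} (divides (suc zero) ())
evenForm {3} (divides (suc (suc _)) ())
evenForm {suc (suc (suc (suc a)))} 2∣4+a with evenForm {a} (∣m+n∣m⇒∣n 2∣4+a (divides 2 refl))
... | four* u   = four* (suc u)
... | 2+four* u = 2+four* (suc u)

-- For even x, phase x holds iff x ≡ 2 (mod 4).
phase : ℕ → Bool
phase 0 = false
phase 1 = false
phase 2 = true
phase 3 = true
phase (suc (suc (suc (suc x)))) = phase x

phase-four* : ∀ u → phase (u * 4) ≡ false
phase-four* zero    = refl
phase-four* (suc u) = phase-four* u

phase-2+four* : ∀ u → phase (2 + u * 4) ≡ true
phase-2+four* zero    = refl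
phase-2+four* (suc u) = phase-2+four* u

signed : Bool → ℤ → ℤ
signed true  z = z
signed false z = - z

signed-signed : ∀ a b z → signed a (signed b z) ≡ signed (not a xor b) z
signed-signed true  b     z = refl
signed-signed false true  z = refl
signed-signed false false z = ℤP.neg-involutive z

signed-+ : ∀ a x y → signed a x ℤ.+ signed a y ≡ signed a (x ℤ.+ y)
signed-+ true  x y = refl
signed-+ false x y = sym (ℤP.neg-distrib-+ x y)

signed-0 : ∀ a → signed a 0ℤ ≡ 0ℤ
signed-0 true  = refl
signed-0 false = refl

sumBelow-signed : ∀ N a h → sumBelow N (λ x → signed a (h x)) ≡ signed a (sumBelow N h)
sumBelow-signed zero    a h = sym (signed-0 a)
sumBelow-signed (suc N) a h =
  trans (cong (λ z → signed a (h 0) ℤ.+ z) (sumBelow-signed N a (h ∘ suc))) (signed-+ a (h 0) _)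

quartetSigns : ℕ → Bool
quartetSigns 0 = true
quartetSigns 1 = false
quartetSigns 2 = false
quartetSigns 3 = true
quartetSigns (suc (suc (suc (suc x)))) = quartetSigns x

sextetSigns : Bool → ℕ → Bool
sextetSigns false 0 = true
sextetSigns false 1 = true
sextetSigns false 2 = false
sextetSigns false 3 = false
sextetSigns false 4 = false
sextetSigns false 5 = true
sextetSigns true  0 = true
sextetSigns true  1 = false
sextetSigns true  2 = false
sextetSigns true  3 = false
sextetSigns true  4 = true
sextetSigns true  5 = true
sextetSigns _ (suc (suc (suc (suc (suc (suc x)))))) = quartetSigns x

segmentSigns : ℕ → ℕ → ℕ → Bool
segmentSigns a m = if phase m then sextetSigns (phase a) else quartetSigns

quartetSigns-sum : ∀ w (g : ℕ → ℕ) → (∀ x → g (4 + x) ≡ 4 + g x) → g 0 + g 3 ≡ g 1 + g 2 →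
                   ∀ b → sumBelow (w * 4) (λ x → signed (quartetSigns x) (+ (b + g x))) ≡ 0ℤ
quartetSigns-sum zero    g periodic balanced b = refl
quartetSigns-sum (suc w) g periodic balanced b =
  trans (ℤSum.sumBelow-+ 4 (w * 4) λ x → signed (quartetSigns x) (+ (b + g x))) (cong₂ ℤ._+_ block rest)
  where
  open ≡-Reasoning
  block : sumBelow 4 (λ x → signed (quartetSigns x) (+ (b + g x))) ≡ 0ℤ
  block = begin
    (+ b ℤ.+ + g 0) ℤ.+ (- (+ b ℤ.+ + g 1) ℤ.+ (- (+ b ℤ.+ + g 2) ℤ.+ ((+ b ℤ.+ + g 3) ℤ.+ 0ℤ)))
      ≡⟨ expand (+ b) (+ g 0) (+ g 1) (+ g 2) (+ g 3) ⟩
    + (g 0 + g 3) ℤ.- + (g 1 + g 2) ≡⟨ cong (λ z → + z ℤ.- + (g 1 + g 2)) balanced ⟩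
    + (g 1 + g 2) ℤ.- + (g 1 + g 2) ≡⟨ ℤP.+-inverseʳ (+ (g 1 + g 2)) ⟩
    0ℤ                              ∎
    where
    expand : ∀ B G₀ G₁ G₂ G₃ → (B ℤ.+ G₀) ℤ.+ (- (B ℤ.+ G₁) ℤ.+ (- (B ℤ.+ G₂) ℤ.+ ((B ℤ.+ G₃) ℤ.+ 0ℤ))) ≡ (G₀ ℤ.+ G₃) ℤ.- (G₁ ℤ.+ G₂)
    expand = solve-∀
  rest : sumBelow (w * 4) (λ x → signed (quartetSigns x) (+ (b + g (4 + x)))) ≡ 0ℤ
  rest = trans (sumBelow-cong (w * 4) λ x → cong (λ y → signed (quartetSigns x) (+ y))
                 (trans (cong (λ y → b + y) (periodic x)) (sym (ℕP.+-assoc b 4 (g x)))))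
               (quartetSigns-sum w g periodic balanced (b + 4))

segmentSigns-sum : ∀ {a m} → EvenForm a → EvenForm m → 3 ≤ m →
                   sumBelow m (λ x → signed (segmentSigns a m x) (+ label (a + x))) ≡ 0ℤ
segmentSigns-sum (four* u) (four* w) _ rewrite phase-four* w =
  trans (sumBelow-cong (w * 4) λ x → cong (λ y → signed (quartetSigns x) (+ suc y)) (swap₁₂-+ u x))
        (quartetSigns-sum w swap₁₂ (λ _ → refl) refl (suc (u * 4)))
segmentSigns-sum (2+four* u) (four* w) _ rewrite phase-four* w =
  trans (sumBelow-cong (w * 4) λ x → cong (λ y → signed (quartetSigns x) (+ suc y)) (swap₁₂-2+ u x))
        (quartetSigns-sum w (λ y → swap₁₂ (2 + y)) (λ _ → refl) refl (suc (u * 4)))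
segmentSigns-sum (four* u) (2+four* suc w) _ rewrite phase-2+four* (suc w) | phase-four* u =
  trans (sumBelow-cong (6 + w * 4) λ x → cong (λ y → signed (sextetSigns false x) (+ suc y)) (swap₁₂-+ u x))
  (trans (ℤSum.sumBelow-+ 6 (w * 4) λ x → signed (sextetSigns false x) (+ (suc (u * 4) + swap₁₂ x)))
         (cong₂ ℤ._+_ (block (+ suc (u * 4))) (quartetSigns-sum w (λ y → swap₁₂ (6 + y)) (λ _ → refl) refl (suc (u * 4)))))
  where
  block : ∀ B → (B ℤ.+ + 0) ℤ.+ ((B ℤ.+ + 2) ℤ.+ (- (B ℤ.+ + 1) ℤ.+ (- (B ℤ.+ + 3) ℤ.+ (- (B ℤ.+ + 4) ℤ.+ ((B ℤ.+ + 6) ℤ.+ 0ℤ))))) ≡ 0ℤ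
  block = solve-∀
segmentSigns-sum (2+four* u) (2+four* suc w) _ rewrite phase-2+four* (suc w) | phase-2+four* u =
  trans (sumBelow-cong (6 + w * 4) λ x → cong (λ y → signed (sextetSigns true x) (+ suc y)) (swap₁₂-2+ u x))
  (trans (ℤSum.sumBelow-+ 6 (w * 4) λ x → signed (sextetSigns true x) (+ (suc (u * 4) + swap₁₂ (2 + x))))
         (cong₂ ℤ._+_ (block (+ suc (u * 4))) (quartetSigns-sum w (λ y → swap₁₂ (8 + y)) (λ _ → refl) refl (suc (u * 4)))))
  where
  block : ∀ B → (B ℤ.+ + 1) ℤ.+ (- (B ℤ.+ + 3) ℤ.+ (- (B ℤ.+ + 4) ℤ.+ (- (B ℤ.+ + 6) ℤ.+ ((B ℤ.+ + 5) ℤ.+ ((B ℤ.+ + 7) ℤ.+ 0ℤ))))) ≡ 0ℤ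
  block = solve-∀
segmentSigns-sum _ (2+four* zero) (s≤s (s≤s ()))

adjacent-labels : ∀ {S} → EvenForm S → 1 ≤ S →
                  signed (phase S) (+ label (S ∸ 1)) ℤ.+ signed (not (phase S)) (+ label S) ≡ + 1
adjacent-labels (four* suc u) _ rewrite phase-four* u =
  trans (cong₂ (λ x y → - (+ suc x) ℤ.+ + suc y) (swap₁₂-c+ 3 u) (swap₁₂-c+ 4 u)) (difference (+ (u * 4)))
  where
  difference : ∀ U → - (+ 1 ℤ.+ (U ℤ.+ + 3)) ℤ.+ (+ 1 ℤ.+ (U ℤ.+ + 4)) ≡ + 1
  difference = solve-∀
adjacent-labels (2+four* u) _ rewrite phase-2+four* u =
  trans (cong₂ (λ x y → + suc x ℤ.+ - (+ suc y)) (swap₁₂-c+ 1 u) (swap₁₂-c+ 2 u)) (difference (+ (u * 4)))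
  where
  difference : ∀ U → (+ 1 ℤ.+ (U ℤ.+ + 2)) ℤ.+ - (+ 1 ℤ.+ (U ℤ.+ + 1)) ≡ + 1
  difference = solve-∀

injective⇒surjective : ∀ {N} (f : Fin N → Fin N) → (∀ x y → f x ≡ f y → x ≡ y) → ∀ y → ∃ λ x → f x ≡ y
injective⇒surjective {suc N} f f-inj y with FinP.any? (λ x → f x FinP.≟ y)
... | yes hit = hit
... | no miss = ⊥-elim (ℕP.<-irrefl refl (FinP.injective⇒≤ {f = squeeze} squeeze-injective))
  where
  avoids : ∀ x → y ≢ f x
  avoids x y≡fx = miss (x , sym y≡fx)
  squeeze : Fin (suc N) → Fin N
  squeeze x = Fin.punchOut (avoids x)
  squeeze-injective : ∀ {x z} → squeeze x ≡ squeeze z → x ≡ z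
  squeeze-injective {x} {z} eq = f-inj x z (FinP.punchOut-injective (avoids x) (avoids z) eq)

surjective⇒injective : ∀ {N} (f : Fin N → Fin N) → (∀ y → ∃ λ x → f x ≡ y) → ∀ x y → f x ≡ f y → x ≡ y
surjective⇒injective f f-surj x y fx≡fy = begin
  x                  ≡⟨ sym (proj₂ (g-surj x)) ⟩
  g (proj₁ (g-surj x)) ≡⟨ cong g preimages-equal ⟩
  g (proj₁ (g-surj y)) ≡⟨ proj₂ (g-surj y) ⟩
  y                  ∎
  where
  open ≡-Reasoning
  g = λ y → proj₁ (f-surj y)
  g-section : ∀ y → f (g y) ≡ y
  g-section y = proj₂ (f-surj y)
  g-surj = injective⇒surjective g λ a b ga≡gb → trans (sym (g-section a)) (trans (cong f ga≡gb) (g-section b))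
  preimages-equal : proj₁ (g-surj x) ≡ proj₁ (g-surj y)
  preimages-equal = begin
    proj₁ (g-surj x)         ≡⟨ sym (g-section _) ⟩
    f (g (proj₁ (g-surj x))) ≡⟨ cong f (proj₂ (g-surj x)) ⟩
    f x                      ≡⟨ fx≡fy ⟩
    f y                      ≡⟨ cong f (sym (proj₂ (g-surj y))) ⟩
    f (g (proj₁ (g-surj y))) ≡⟨ g-section _ ⟩
    proj₁ (g-surj y)         ∎

bounded-surjective⇒injective : ∀ {M} (pos : Fin M → ℕ) → (∀ e → pos e < M) → (∀ y → y < M → ∃ λ e → pos e ≡ y) →
                               ∀ e e′ → pos e ≡ pos e′ → e ≡ e′
bounded-surjective⇒injective {M} pos pos< pos-onto e e′ eq =
  surjective⇒injective pos′ pos′-surjective e e′ (FinP.toℕ-injective (trans (toℕ-pos′ e) (trans eq (sym (toℕ-pos′ e′)))))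
  where
  pos′ : Fin M → Fin M
  pos′ e = Fin.fromℕ< (pos< e)
  toℕ-pos′ : ∀ e → toℕ (pos′ e) ≡ pos e
  toℕ-pos′ e = FinP.toℕ-fromℕ< (pos< e)
  pos′-surjective : ∀ y → ∃ λ e → pos′ e ≡ y
  pos′-surjective y with pos-onto (toℕ y) (FinP.toℕ<n y)
  ... | e , pos-e≡y = e , FinP.toℕ-injective (trans (toℕ-pos′ e) pos-e≡y)

LabelsExactly : ℕ → (ℕ → Set) → Set
LabelsExactly M L = (∀ y → y < M → L (label y)) × (∀ l → L l → ∃ λ y → y < M × label y ≡ l)

labels-conservative : ∀ {M} → 4 ∣ M → LabelsExactly M (λ l → 1 ≤ l × l ≤ M)
labels-conservative (divides u refl) = (λ y y< → s≤s z≤n , swap₁₂-< u y y<) , onto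
  where
  onto : ∀ l → 1 ≤ l × l ≤ u * 4 → ∃ λ y → y < u * 4 × label y ≡ l
  onto (suc y) (_ , y<) = swap₁₂ y , swap₁₂-< u y y< , cong suc (swap₁₂-involutive y)

-- For M = 4u + 2 the last two positions 4u, 4u + 1 get the labels M − 1 and M + 1.
labels-nearConservative : ∀ {M} → EvenForm M → ¬ 4 ∣ M → LabelsExactly M (λ l → (1 ≤ l × l ≤ M ∸ 1) ⊎ l ≡ suc M)
labels-nearConservative (four* u)   4∤M = ⊥-elim (4∤M (divides u refl))
labels-nearConservative (2+four* u) _   = into , onto
  where
  U = u * 4
  into : ∀ y → y < 2 + U → (1 ≤ label y × label y ≤ 1 + U) ⊎ label y ≡ suc (2 + U)
  into y y< with y ℕ.<? U
  ... | yes y<U = inj₁ (s≤s z≤n , ℕP.m≤n⇒m≤1+n (swap₁₂-< u y y<U))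
  ... | no y≮U with ℕP.m≤n⇒m<n∨m≡n (ℕP.≤-pred y<)
  ...   | inj₁ y<1+U rewrite ℕP.≤-antisym (ℕP.≤-pred y<1+U) (ℕP.≮⇒≥ y≮U) =
          inj₁ (s≤s z≤n , s≤s (ℕP.≤-reflexive (swap₁₂-four* u)))
  ...   | inj₂ refl = inj₂ (cong suc (swap₁₂-four*+1 u))
  onto : ∀ l → (1 ≤ l × l ≤ 1 + U) ⊎ l ≡ suc (2 + U) → ∃ λ y → y < 2 + U × label y ≡ l
  onto (suc y) (inj₁ (_ , s≤s y≤U)) with ℕP.m≤n⇒m<n∨m≡n y≤U
  ... | inj₁ y<U = swap₁₂ y , ℕP.<-≤-trans (swap₁₂-< u y y<U) (ℕP.m≤n+m U 2) , cong suc (swap₁₂-involutive y)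
  ... | inj₂ refl = U , ℕP.m<n⇒m<1+n (ℕP.n<1+n U) , cong suc (swap₁₂-four* u)
  onto _ (inj₂ refl) = suc U , ℕP.n<1+n (suc U) , cong suc (swap₁₂-four*+1 u)

isLabeling-label∘ : (G : Graph) (let open Graph G) (pos : Fin m → ℕ) → (∀ e → pos e < m) →
                    (∀ y → y < m → ∃ λ e → pos e ≡ y) → ∀ {L} → LabelsExactly m L → IsLabeling G L (label ∘ pos)
isLabeling-label∘ G pos pos< pos-onto (label-into , label-onto) = record
  { into = λ e → label-into (pos e) (pos< e)
  ; inj  = λ e e′ eq → bounded-surjective⇒injective pos pos< pos-onto e e′ (swap₁₂-injective _ _ (ℕP.suc-injective eq))
  ; onto = onto
  }
  where
  onto : ∀ l → _ → ∃ λ e → label (pos e) ≡ l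
  onto l l∈L with label-onto l l∈L
  ... | y , y< , label-y≡l with pos-onto y y<
  ...   | e , pos-e≡y = e , trans (cong label pos-e≡y) label-y≡l

module Arcs {V : Set} (_≟_ : DecidableEquality V) where

  arc : Bool → V × V → ℕ → V → ℤ
  arc b q L u = (if does ((if b then proj₂ q else proj₁ q) ≟ u) then + L else 0ℤ)
            ℤ.- (if does ((if b then proj₁ q else proj₂ q) ≟ u) then + L else 0ℤ)

  arc-head : ∀ b x y L → x ≢ y → arc b (x , y) L y ≡ signed b (+ L)
  arc-head true  x y L x≢y rewrite dec-true (y ≟ y) refl | dec-false (x ≟ y) x≢y = ℤP.+-identityʳ (+ L)
  arc-head false x y L x≢y rewrite dec-true (y ≟ y) refl | dec-false (x ≟ y) x≢y = ℤP.+-identityˡ (- + L)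

  arc-tail : ∀ b x y L → x ≢ y → arc b (x , y) L x ≡ signed (not b) (+ L)
  arc-tail true  x y L x≢y rewrite dec-true (x ≟ x) refl | dec-false (y ≟ x) (x≢y ∘ sym) = ℤP.+-identityˡ (- + L)
  arc-tail false x y L x≢y rewrite dec-true (x ≟ x) refl | dec-false (y ≟ x) (x≢y ∘ sym) = ℤP.+-identityʳ (+ L)

  arc-apart : ∀ b x y L u → x ≢ u → y ≢ u → arc b (x , y) L u ≡ 0ℤ
  arc-apart true  x y L u x≢u y≢u rewrite dec-false (x ≟ u) x≢u | dec-false (y ≟ u) y≢u = refl
  arc-apart false x y L u x≢u y≢u rewrite dec-false (x ≟ u) x≢u | dec-false (y ≟ u) y≢u = refl

-- The edge list of a snowflake is the concatenation of its stars; slot 0 of star i is the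
-- edge to the centre and slot 1 + k the edge to leaf k.
module SnowflakeStructure (p : ℕ) (n : Fin p → ℕ) where

  open Arcs (_≟SV_ {p} {n})

  private
    V = SV p n
    G = snowflake p n
    edges = snowEdges p n

  leaves : Fin p → ℕ
  leaves i = n i ∸ 1

  star : Fin p → List (V × V)
  star i = (cen , hub i) ∷ map (λ k → (hub i , leaf i k)) (allFin (leaves i))

  -- s i j is the sign with which the label of slot j of star i enters the vertex sum at hub i.
  orient : (Fin p → ℕ → Bool) → V × V → Bool
  orient s (cen , hub i)      = s i 0
  orient s (hub _ , leaf i k) = not (s i (suc (toℕ k)))
  orient s _                  = true

  slot : (Fin p → ℕ → ℕ) → V × V → ℕ
  slot P (cen , hub i)      = P i 0
  slot P (hub _ , leaf i k) = P i (suc (toℕ k))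
  slot P _                  = 0

  map-star : ∀ {B : Set} (f : V × V → B) i → map f (star i) ≡ f (cen , hub i) ∷ map (λ k → f (hub i , leaf i k)) (allFin (leaves i))
  map-star f i = cong (f (cen , hub i) ∷_) (sym (ListP.map-∘ (allFin (leaves i))))

  module StarSums {A : Set} {_∙_ : Op₂ A} {ε : A}
    (isCommutativeMonoid : Structures.IsCommutativeMonoid {A = A} _≡_ _∙_ ε) where

    open Summation isCommutativeMonoid using (Σ; Σ-map-concatMap; Σ-map-ε)
    open Structures.IsCommutativeMonoid isCommutativeMonoid using (identityˡ)

    Σ-edges : ∀ (f : V × V → A) → Σ (tabulate (f ∘ lookup edges)) ≡ Σ (map (λ i → Σ (map f (star i))) (allFin p))
    Σ-edges f = trans (cong Σ (trans (sym (ListP.map-tabulate (lookup edges) f)) (cong (map f) (ListP.tabulate-lookup edges))))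
                      (Σ-map-concatMap f star (allFin p))

    Σ-star : ∀ (f : V × V → A) i → Σ (map f (star i)) ≡ f (cen , hub i) ∙ Σ (map (λ k → f (hub i , leaf i k)) (allFin (leaves i)))
    Σ-star f i = cong Σ (map-star f i)

    Σ-star-apart : ∀ (f : V × V → A) u → (∀ x y → x ≢ u → y ≢ u → f (x , y) ≡ ε) →
                   ∀ i → cen ≢ u → hub i ≢ u → (∀ k → leaf i k ≢ u) → Σ (map f (star i)) ≡ ε
    Σ-star-apart f u f-apart i cen≢u hub≢u leaf≢u =
      trans (Σ-star f i) (trans (cong₂ _∙_ (f-apart cen (hub i) cen≢u hub≢u)
                                           (Σ-map-ε _ (λ k → f-apart (hub i) (leaf i k) hub≢u (leaf≢u k)) (allFin (leaves i))))
                                (identityˡ ε))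

  private
    module ℤStar = StarSums ℤP.+-0-isCommutativeMonoid
    module ℕStar = StarSums ℕP.+-0-isCommutativeMonoid

  module _ (s : Fin p → ℕ → Bool) (P : Fin p → ℕ → ℕ) where

    private
      term : V → V × V → ℤ
      term u q = arc (orient s q) q (label (slot P q)) u

      term-head : ∀ x y → x ≢ y → term y (x , y) ≡ signed (orient s (x , y)) (+ label (slot P (x , y)))
      term-head x y = arc-head (orient s (x , y)) x y (label (slot P (x , y)))

      term-tail : ∀ x y → x ≢ y → term x (x , y) ≡ signed (not (orient s (x , y))) (+ label (slot P (x , y)))
      term-tail x y = arc-tail (orient s (x , y)) x y (label (slot P (x , y)))

      term-apart : ∀ u x y → x ≢ u → y ≢ u → term u (x , y) ≡ 0ℤ
      term-apart u x y = arc-apart (orient s (x , y)) x y (label (slot P (x , y))) u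

    vsum-hub : ∀ i → vsum G (orient s ∘ lookup edges) (label ∘ slot P ∘ lookup edges) (hub i) ≡
                     sumBelow (suc (leaves i)) (λ j → signed (s i j) (+ label (P i j)))
    vsum-hub i = begin
      ℤSum.Σ (tabulate (term (hub i) ∘ lookup edges))                           ≡⟨ ℤStar.Σ-edges (term (hub i)) ⟩
      ℤSum.Σ (map (λ i′ → ℤSum.Σ (map (term (hub i)) (star i′))) (allFin p))  ≡⟨ ℤSum.Σ-allFin-single _ i other ⟩
      ℤSum.Σ (map (term (hub i)) (star i))                                     ≡⟨ ℤStar.Σ-star (term (hub i)) i ⟩
      term (hub i) (cen , hub i) ℤ.+ ℤSum.Σ (map (λ k → term (hub i) (hub i , leaf i k)) (allFin (leaves i)))
        ≡⟨ cong₂ ℤ._+_ (term-head cen (hub i) λ ()) (ℤSum.Σ-allFin _ _ leaf-term) ⟩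
      sumBelow (suc (leaves i)) (λ j → signed (s i j) (+ label (P i j)))       ∎
      where
      open ≡-Reasoning
      other : ∀ i′ → i′ ≢ i → ℤSum.Σ (map (term (hub i)) (star i′)) ≡ 0ℤ
      other i′ i′≢i = ℤStar.Σ-star-apart (term (hub i)) (hub i) (term-apart (hub i)) i′ (λ ()) (λ { refl → i′≢i refl }) (λ _ ())
      leaf-term : ∀ k → term (hub i) (hub i , leaf i k) ≡ signed (s i (suc (toℕ k))) (+ label (P i (suc (toℕ k))))
      leaf-term k = trans (term-tail (hub i) (leaf i k) λ ()) (cong (λ b → signed b (+ label (P i (suc (toℕ k))))) (BoolP.not-involutive (s i (suc (toℕ k)))))

    vsum-cen : vsum G (orient s ∘ lookup edges) (label ∘ slot P ∘ lookup edges) cen ≡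
               ℤSum.Σ (map (λ i → signed (not (s i 0)) (+ label (P i 0))) (allFin p))
    vsum-cen = trans (ℤStar.Σ-edges (term cen)) (cong ℤSum.Σ (ListP.map-cong star-term (allFin p)))
      where
      star-term : ∀ i → ℤSum.Σ (map (term cen) (star i)) ≡ signed (not (s i 0)) (+ label (P i 0))
      star-term i = trans (ℤStar.Σ-star (term cen) i)
        (trans (cong₂ ℤ._+_ (term-tail cen (hub i) λ ())
                            (ℤSum.Σ-map-ε _ (λ k → term-apart cen (hub i) (leaf i k) (λ ()) λ ()) (allFin (leaves i))))
               (ℤP.+-identityʳ _))

  private
    incidence : V → V × V → ℕ
    incidence u q = ind G (does (proj₁ q ≟SV u)) + ind G (does (proj₂ q ≟SV u))

    incidence-apart : ∀ u x y → x ≢ u → y ≢ u → incidence u (x , y) ≡ 0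
    incidence-apart u x y x≢u y≢u rewrite dec-false (x ≟SV u) x≢u | dec-false (y ≟SV u) y≢u = refl

    incidence-head : ∀ x y → x ≢ y → incidence y (x , y) ≡ 1
    incidence-head x y x≢y rewrite dec-false (x ≟SV y) x≢y | dec-true (y ≟SV y) refl = refl

    incidence-tail : ∀ x y → x ≢ y → incidence x (x , y) ≡ 1
    incidence-tail x y x≢y rewrite dec-true (x ≟SV x) refl | dec-false (y ≟SV x) (x≢y ∘ sym) = refl

    Σ-ones : ∀ N → ℕSum.Σ (map (λ (_ : Fin N) → 1) (allFin N)) ≡ N
    Σ-ones N = trans (ℕSum.Σ-allFin {N} (λ _ → 1) (λ _ → 1) (λ _ → refl)) (sumBelow-ones N)
      where
      sumBelow-ones : ∀ N → ℕSum.sumBelow N (λ _ → 1) ≡ N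
      sumBelow-ones zero    = refl
      sumBelow-ones (suc N) = cong suc (sumBelow-ones N)

  degree-hub : ∀ i → 1 ≤ n i → degree G (hub i) ≡ n i
  degree-hub i 1≤n = begin
    ℕSum.Σ (tabulate (incidence (hub i) ∘ lookup edges))                        ≡⟨ ℕStar.Σ-edges (incidence (hub i)) ⟩
    ℕSum.Σ (map (λ i′ → ℕSum.Σ (map (incidence (hub i)) (star i′))) (allFin p)) ≡⟨ ℕSum.Σ-allFin-single _ i other ⟩
    ℕSum.Σ (map (incidence (hub i)) (star i))                                   ≡⟨ ℕStar.Σ-star (incidence (hub i)) i ⟩
    incidence (hub i) (cen , hub i) + ℕSum.Σ (map (λ k → incidence (hub i) (hub i , leaf i k)) (allFin (leaves i)))
      ≡⟨ cong₂ _+_ (incidence-head cen (hub i) λ ())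
                   (trans (cong ℕSum.Σ (ListP.map-cong (λ k → incidence-tail (hub i) (leaf i k) λ ()) (allFin (leaves i)))) (Σ-ones (leaves i))) ⟩
    suc (n i ∸ 1)                                                               ≡⟨ ℕP.+-comm 1 (n i ∸ 1) ⟩
    n i ∸ 1 + 1                                                                 ≡⟨ ℕP.m∸n+n≡m 1≤n ⟩
    n i                                                                         ∎
    where
    open ≡-Reasoning
    other : ∀ i′ → i′ ≢ i → ℕSum.Σ (map (incidence (hub i)) (star i′)) ≡ 0
    other i′ i′≢i = ℕStar.Σ-star-apart (incidence (hub i)) (hub i) (incidence-apart (hub i)) i′ (λ ()) (λ { refl → i′≢i refl }) (λ _ ())

  degree-cen : degree G cen ≡ p
  degree-cen = trans (ℕStar.Σ-edges (incidence cen)) (trans (cong ℕSum.Σ (ListP.map-cong star-term (allFin p))) (Σ-ones p))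
    where
    star-term : ∀ i → ℕSum.Σ (map (incidence cen) (star i)) ≡ 1
    star-term i = trans (ℕStar.Σ-star (incidence cen) i)
      (cong₂ _+_ (incidence-tail cen (hub i) λ ())
                 (ℕSum.Σ-map-ε _ (λ k → incidence-apart cen (hub i) (leaf i k) (λ ()) λ ()) (allFin (leaves i))))

  degree-leaf : ∀ i k → degree G (leaf i k) ≡ 1
  degree-leaf i k = begin
    ℕSum.Σ (tabulate (incidence (leaf i k) ∘ lookup edges))                        ≡⟨ ℕStar.Σ-edges (incidence (leaf i k)) ⟩
    ℕSum.Σ (map (λ i′ → ℕSum.Σ (map (incidence (leaf i k)) (star i′))) (allFin p)) ≡⟨ ℕSum.Σ-allFin-single _ i other ⟩
    ℕSum.Σ (map (incidence (leaf i k)) (star i))                                   ≡⟨ ℕStar.Σ-star (incidence (leaf i k)) i ⟩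
    incidence (leaf i k) (cen , hub i) + ℕSum.Σ (map (λ k′ → incidence (leaf i k) (hub i , leaf i k′)) (allFin (leaves i)))
      ≡⟨ cong₂ _+_ (incidence-apart (leaf i k) cen (hub i) (λ ()) λ ()) (ℕSum.Σ-allFin-single _ k other-leaf) ⟩
    incidence (leaf i k) (hub i , leaf i k)                                        ≡⟨ incidence-head (hub i) (leaf i k) (λ ()) ⟩
    1                                                                              ∎
    where
    open ≡-Reasoning
    other : ∀ i′ → i′ ≢ i → ℕSum.Σ (map (incidence (leaf i k)) (star i′)) ≡ 0
    other i′ i′≢i = ℕStar.Σ-star-apart (incidence (leaf i k)) (leaf i k) (incidence-apart (leaf i k)) i′ (λ ()) (λ ()) (λ { _ refl → i′≢i refl })
    other-leaf : ∀ k′ → k′ ≢ k → incidence (leaf i k) (hub i , leaf i k′) ≡ 0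
    other-leaf k′ k′≢k = incidence-apart (leaf i k) (hub i) (leaf i k′) (λ ()) λ { refl → k′≢k refl }

  edge-count : Graph.m G ≡ ℕSum.Σ (map (λ i → suc (leaves i)) (allFin p))
  edge-count = trans (length-as-Σ edges) (trans (ℕSum.Σ-map-concatMap (λ _ → 1) star (allFin p)) (cong ℕSum.Σ (ListP.map-cong star-size (allFin p))))
    where
    length-as-Σ : ∀ {B : Set} (xs : List B) → length xs ≡ ℕSum.Σ (map (λ _ → 1) xs)
    length-as-Σ []       = refl
    length-as-Σ (x ∷ xs) = cong suc (length-as-Σ xs)
    star-size : ∀ i → ℕSum.Σ (map (λ _ → 1) (star i)) ≡ suc (leaves i)
    star-size i = trans (ℕStar.Σ-star (λ _ → 1) i) (cong suc (Σ-ones (leaves i)))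

  slot-of-edge : ∀ P e → ∃ λ i → ∃ λ j → j < suc (leaves i) × slot P (lookup edges e) ≡ P i j
  slot-of-edge P e with Any.satisfied (∈-concatMap⁻ star {xs = allFin p} (∈-lookup {xs = edges} e))
  ... | i , here eq = i , 0 , s≤s z≤n , cong (slot P) eq
  ... | i , there q∈ with ∈-map⁻ (λ k → (hub i , leaf i k)) q∈
  ...   | k , _ , eq = i , suc (toℕ k) , s≤s (FinP.toℕ<n k) , cong (slot P) eq

  edge-of : ∀ P i {q} → q ∈ star i → ∃ λ e → slot P (lookup edges e) ≡ slot P q
  edge-of P i {q} q∈ = Any.index q∈edges , cong (slot P) (sym (AnyP.lookup-index q∈edges))
    where
    q∈edges : q ∈ edges
    q∈edges = ∈-concatMap⁺ star (Any.map (λ { refl → q∈ }) (∈-allFin i))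

  edge-at-slot : ∀ P i j → j < suc (leaves i) → ∃ λ e → slot P (lookup edges e) ≡ P i j
  edge-at-slot P i zero    _        = edge-of P i (here refl)
  edge-at-slot P i (suc j) (s≤s j<) with edge-of P i (there (∈-map⁺ (λ k → (hub i , leaf i k)) (∈-allFin (Fin.fromℕ< j<))))
  ... | e , eq = e , trans eq (cong (λ x → P i (suc x)) (FinP.toℕ-fromℕ< j<))

isOdd : ℕ → Bool
isOdd zero    = false
isOdd (suc k) = not (isOdd k)

data ParityView : ℕ → Set where
  even : ∀ t → ParityView (t * 2)
  odd  : ∀ t → ParityView (suc (t * 2))

parityView : ∀ k → ParityView k
parityView zero = even 0
parityView (suc k) with parityView k
... | even t = odd t
... | odd t  = even (suc t)

alternate : {A : Set} → (ℕ → A) → (ℕ → A) → ℕ → A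
alternate f g zero    = f 0
alternate f g (suc k) = alternate g (f ∘ suc) k

alternate-even : ∀ {A : Set} (f g : ℕ → A) t → alternate f g (t * 2) ≡ f t
alternate-even f g zero    = refl
alternate-even f g (suc t) = alternate-even (f ∘ suc) (g ∘ suc) t

alternate-odd : ∀ {A : Set} (f g : ℕ → A) t → alternate f g (suc (t * 2)) ≡ g t
alternate-odd f g t = alternate-even g (f ∘ suc) t

pairTarget : ℕ → Bool
pairTarget t = (t ≡ᵇ 0) ∨ isOdd t

startSlot : ℕ → ℕ
startSlot q = if isOdd q then 0 else 2

-- The partial sums of + + − + − … alternate 1, 2, 1, 2, …, i.e. label 0, label 2, label 0, ….
pairTargets-sum : ∀ q → sumBelow (suc q) (λ t → signed (pairTarget t) (+ 1)) ≡ + label (startSlot (suc q))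
pairTargets-sum zero    = refl
pairTargets-sum (suc q) =
  trans (ℤSum.sumBelow-suc (suc q) λ t → signed (pairTarget t) (+ 1))
        (trans (cong (ℤ._+ signed (isOdd (suc q)) (+ 1)) (pairTargets-sum q)) (step (isOdd q)))
  where
  step : ∀ b → + label (if not b then 0 else 2) ℤ.+ signed (not b) (+ 1) ≡ + label (if not (not b) then 0 else 2)
  step true  = refl
  step false = refl

1≤half : ∀ {q} → 3 ≤ suc (q * 2) → 1 ≤ q
1≤half {zero}  (s≤s ())
1≤half {suc q} _ = s≤s z≤n

module Construction (q : ℕ) (n : Fin (suc (q * 2)) → ℕ) (n≥3 : ∀ i → 3 ≤ n i) (n-even : ∀ i → 2 ∣ n i) where

  p : ℕ
  p = suc (q * 2)

  open SnowflakeStructure p n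

  private
    G = snowflake p n
    edges = snowEdges p n

  -- n, extended by 0 beyond p so that stars can be indexed by natural numbers.
  size : ℕ → ℕ
  size k with k ℕ.<? p
  ... | yes k<p = n (Fin.fromℕ< k<p)
  ... | no  _   = 0

  size-toℕ : ∀ i → size (toℕ i) ≡ n i
  size-toℕ i with toℕ i ℕ.<? p
  ... | yes i<p = cong n (FinP.fromℕ<-toℕ i i<p)
  ... | no  i≮p = ⊥-elim (i≮p (FinP.toℕ<n i))

  size-even : ∀ k → 2 ∣ size k
  size-even k with k ℕ.<? p
  ... | yes k<p = n-even (Fin.fromℕ< k<p)
  ... | no  _   = divides 0 refl

  size≥3 : ∀ k → k < p → 3 ≤ size k
  size≥3 k k<p with k ℕ.<? p
  ... | yes k<p′ = n≥3 (Fin.fromℕ< k<p′)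
  ... | no  k≮p  = ⊥-elim (k≮p k<p)

  offset : ℕ → ℕ
  offset k = ℕSum.sumBelow k size

  offset-suc : ∀ k → offset (suc k) ≡ offset k + size k
  offset-suc k = ℕSum.sumBelow-suc k size

  offset-even : ∀ k → 2 ∣ offset k
  offset-even zero    = divides 0 refl
  offset-even (suc k) = subst (2 ∣_) (sym (offset-suc k)) (∣m∣n⇒∣m+n (offset-even k) (size-even k))

  offset-mono : ∀ {k K} → k ≤ K → offset k ≤ offset K
  offset-mono {k} {K} k≤K = subst (λ K → offset k ≤ offset K) (ℕP.m+[n∸m]≡n k≤K)
    (subst (offset k ≤_) (sym (ℕSum.sumBelow-+ k (K ∸ k) size)) (ℕP.m≤m+n (offset k) _))

  centreSlot : ℕ → ℕ
  centreSlot zero    = startSlot q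
  centreSlot (suc k) = alternate (λ t → size (suc (t * 2)) ∸ 1) (λ _ → 0) k

  centreSlot<size : ∀ k → k < p → centreSlot k < size k
  centreSlot<size zero k<p with isOdd q
  ... | true  = ℕP.<-≤-trans (s≤s z≤n) (size≥3 0 k<p)
  ... | false = size≥3 0 k<p
  centreSlot<size (suc k) k<p with parityView k
  ... | even t rewrite alternate-even (λ t → size (suc (t * 2)) ∸ 1) (λ _ → 0) t =
          ℕP.∸-monoʳ-< {n = 1} {o = 0} (s≤s z≤n) (ℕP.≤-trans (s≤s z≤n) (size≥3 _ k<p))
  ... | odd t rewrite alternate-odd (λ t → size (suc (t * 2)) ∸ 1) (λ _ → 0) t =
          ℕP.<-≤-trans (s≤s z≤n) (size≥3 _ k<p)

  centreSign : ℕ → Bool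
  centreSign zero    = false
  centreSign (suc k) = alternate (λ t → not (pairTarget t) xor phase (offset (2 + t * 2)))
                                 (λ t → not (pairTarget t) xor not (phase (offset (2 + t * 2)))) k

  starSigns : ℕ → ℕ → Bool
  starSigns k = segmentSigns (offset k) (size k)

  starFlip : ℕ → Bool
  starFlip k = centreSign k xor starSigns k (centreSlot k)

  hubSign : ℕ → ℕ → Bool
  hubSign k x = not (starFlip k) xor starSigns k x

  hubSign-centre : ∀ k → hubSign k (centreSlot k) ≡ not (centreSign k)
  hubSign-centre k = cancel (centreSign k) (starSigns k (centreSlot k))
    where
    cancel : ∀ a b → not (a xor b) xor b ≡ not a
    cancel true  true  = refl
    cancel true  false = refl
    cancel false true  = refl
    cancel false false = refl

  signs : Fin p → ℕ → Bool
  signs i j = hubSign (toℕ i) (transpose₀ (centreSlot (toℕ i)) j)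

  positions : Fin p → ℕ → ℕ
  positions i j = offset (toℕ i) + transpose₀ (centreSlot (toℕ i)) j

  orientation : Fin (Graph.m G) → Bool
  orientation = orient signs ∘ lookup edges

  position : Fin (Graph.m G) → ℕ
  position = slot positions ∘ lookup edges

  star-size : ∀ i → suc (leaves i) ≡ size (toℕ i)
  star-size i = trans (ℕP.+-comm 1 (n i ∸ 1)) (trans (ℕP.m∸n+n≡m (ℕP.≤-trans (s≤s z≤n) (n≥3 i))) (sym (size-toℕ i)))

  vsum-hub-zero : ∀ i → vsum G orientation (label ∘ position) (hub i) ≡ 0ℤ
  vsum-hub-zero i = begin
    vsum G orientation (label ∘ position) (hub i)                         ≡⟨ vsum-hub signs positions i ⟩
    sumBelow (suc (leaves i)) (λ j → signed (signs i j) (+ label (positions i j)))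
      ≡⟨ cong (λ N → sumBelow N λ j → signed (signs i j) (+ label (positions i j))) (star-size i) ⟩
    sumBelow (size k) (h ∘ transpose₀ (centreSlot k))                      ≡⟨ ℤSum.sumBelow-transpose₀ (size k) (centreSlot k) h (centreSlot<size k k<p) ⟩
    sumBelow (size k) h                                                    ≡⟨ sumBelow-cong (size k) (λ x → sym (signed-signed (starFlip k) (starSigns k x) _)) ⟩
    sumBelow (size k) (λ x → signed (starFlip k) (segmentTerm x))          ≡⟨ sumBelow-signed (size k) (starFlip k) segmentTerm ⟩
    signed (starFlip k) (sumBelow (size k) segmentTerm)
      ≡⟨ cong (signed (starFlip k)) (segmentSigns-sum (evenForm (offset-even k)) (evenForm (size-even k)) (size≥3 k k<p)) ⟩
    signed (starFlip k) 0ℤ                                                 ≡⟨ signed-0 (starFlip k) ⟩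
    0ℤ                                                                     ∎
    where
    open ≡-Reasoning
    k = toℕ i
    k<p = FinP.toℕ<n i
    h : ℕ → ℤ
    h x = signed (hubSign k x) (+ label (offset k + x))
    segmentTerm : ℕ → ℤ
    segmentTerm x = signed (starSigns k x) (+ label (offset k + x))

  centreTerm : ℕ → ℤ
  centreTerm k = signed (centreSign k) (+ label (offset k + centreSlot k))

  vsum-cen-centreTerms : vsum G orientation (label ∘ position) cen ≡ sumBelow p centreTerm
  vsum-cen-centreTerms = trans (vsum-cen signs positions) (ℤSum.Σ-allFin _ centreTerm term)
    where
    term : ∀ i → signed (not (signs i 0)) (+ label (positions i 0)) ≡ centreTerm (toℕ i)
    term i = cong (λ b → signed b (+ label (positions i 0)))
                  (trans (cong not (hubSign-centre (toℕ i))) (BoolP.not-involutive _))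

  centrePair : ∀ t → suc (t * 2) < p → centreTerm (suc (t * 2)) ℤ.+ centreTerm (suc (suc (t * 2))) ≡ signed (pairTarget t) (+ 1)
  centrePair t 2t+1<p = begin
    centreTerm (suc (t * 2)) ℤ.+ centreTerm (suc (suc (t * 2)))
      ≡⟨ cong₂ ℤ._+_ (cong₂ (λ b x → signed b (+ label (offset (suc (t * 2)) + x))) (alternate-even F₁ F₂ t) (alternate-even f₁ f₂ t))
                     (cong₂ (λ b x → signed b (+ label (offset (suc (suc (t * 2))) + x))) (alternate-odd F₁ F₂ t) (alternate-odd f₁ f₂ t)) ⟩
    signed (not τ xor ph) (+ label (offset (suc (t * 2)) + (size (suc (t * 2)) ∸ 1))) ℤ.+ signed (not τ xor not ph) (+ label (S + 0))
      ≡⟨ cong₂ (λ x y → signed (not τ xor ph) (+ label x) ℤ.+ signed (not τ xor not ph) (+ label y)) last-of-odd-star (ℕP.+-identityʳ S) ⟩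
    signed (not τ xor ph) (+ label (S ∸ 1)) ℤ.+ signed (not τ xor not ph) (+ label S)
      ≡⟨ sym (cong₂ ℤ._+_ (signed-signed τ ph _) (signed-signed τ (not ph) _)) ⟩
    signed τ (signed ph (+ label (S ∸ 1))) ℤ.+ signed τ (signed (not ph) (+ label S))
      ≡⟨ signed-+ τ _ _ ⟩
    signed τ (signed ph (+ label (S ∸ 1)) ℤ.+ signed (not ph) (+ label S))
      ≡⟨ cong (signed τ) (adjacent-labels (evenForm (offset-even (suc (suc (t * 2))))) 1≤S) ⟩
    signed τ (+ 1) ∎
    where
    open ≡-Reasoning
    τ = pairTarget t
    S = offset (suc (suc (t * 2)))
    ph = phase S
    F₁ F₂ : ℕ → Bool
    F₁ t = not (pairTarget t) xor phase (offset (2 + t * 2))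
    F₂ t = not (pairTarget t) xor not (phase (offset (2 + t * 2)))
    f₁ f₂ : ℕ → ℕ
    f₁ t = size (suc (t * 2)) ∸ 1
    f₂ _ = 0
    1≤size : 1 ≤ size (suc (t * 2))
    1≤size = ℕP.≤-trans (s≤s z≤n) (size≥3 _ 2t+1<p)
    last-of-odd-star : offset (suc (t * 2)) + (size (suc (t * 2)) ∸ 1) ≡ S ∸ 1
    last-of-odd-star = sym (trans (cong (_∸ 1) (offset-suc (suc (t * 2)))) (ℕP.+-∸-assoc (offset (suc (t * 2))) 1≤size))
    1≤S : 1 ≤ S
    1≤S = subst (1 ≤_) (sym (offset-suc (suc (t * 2)))) (ℕP.≤-trans 1≤size (ℕP.m≤n+m _ (offset (suc (t * 2)))))

  vsum-cen-zero : 1 ≤ q → vsum G orientation (label ∘ position) cen ≡ 0ℤ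
  vsum-cen-zero 1≤q = begin
    vsum G orientation (label ∘ position) cen                                   ≡⟨ vsum-cen-centreTerms ⟩
    centreTerm 0 ℤ.+ sumBelow (q * 2) (centreTerm ∘ suc)                       ≡⟨ cong (λ z → centreTerm 0 ℤ.+ z) (ℤSum.sumBelow-pairs q (centreTerm ∘ suc)) ⟩
    centreTerm 0 ℤ.+ sumBelow q (λ t → centreTerm (suc (t * 2)) ℤ.+ centreTerm (suc (suc (t * 2))))
      ≡⟨ cong (λ z → centreTerm 0 ℤ.+ z) (ℤSum.sumBelow-cong< q λ t t<q → centrePair t (s≤s (ℕP.*-monoˡ-< 2 t<q))) ⟩
    centreTerm 0 ℤ.+ sumBelow q (λ t → signed (pairTarget t) (+ 1))            ≡⟨ cancel q 1≤q ⟩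
    0ℤ                                                                          ∎
    where
    open ≡-Reasoning
    cancel : ∀ q′ → 1 ≤ q′ → - (+ label (startSlot q′)) ℤ.+ sumBelow q′ (λ t → signed (pairTarget t) (+ 1)) ≡ 0ℤ
    cancel (suc q′) _ = trans (cong (λ z → - (+ label (startSlot (suc q′))) ℤ.+ z) (pairTargets-sum q′)) (ℤP.+-inverseˡ (+ label (startSlot (suc q′))))

  edges-offset : Graph.m G ≡ offset p
  edges-offset = trans edge-count (ℕSum.Σ-allFin (λ i → suc (leaves i)) size star-size)

  slot-bound : ∀ i x → x < size (toℕ i) → transpose₀ (centreSlot (toℕ i)) x < suc (leaves i)
  slot-bound i x x< = subst (transpose₀ (centreSlot (toℕ i)) x <_) (sym (star-size i)) (transpose₀-< _ x (centreSlot<size (toℕ i) (FinP.toℕ<n i)) x<)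

  positions< : ∀ i j → j < suc (leaves i) → positions i j < offset p
  positions< i j j< = ℕP.<-≤-trans (ℕP.+-monoʳ-< (offset k) (transpose₀-< _ j (centreSlot<size k (FinP.toℕ<n i)) (subst (j <_) (star-size i) j<)))
                                   (ℕP.≤-trans (ℕP.≤-reflexive (sym (offset-suc k))) (offset-mono (FinP.toℕ<n i)))
    where k = toℕ i

  position< : ∀ e → position e < Graph.m G
  position< e with slot-of-edge positions e
  ... | i , j , j< , pos≡ = subst₂ _<_ (sym pos≡) (sym edges-offset) (positions< i j j<)

  locate : ∀ K → K ≤ p → ∀ y → y < offset K → ∃ λ (i : Fin p) → offset (toℕ i) ≤ y × y < offset (toℕ i) + size (toℕ i)
  locate (suc K) K<p y y< with y ℕ.<? offset K
  ... | yes y<K = locate K (ℕP.<⇒≤ K<p) y y<K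
  ... | no  y≮K = Fin.fromℕ< K<p , subst (λ k → offset k ≤ y × y < offset k + size k) (sym (FinP.toℕ-fromℕ< K<p))
                                         (ℕP.≮⇒≥ y≮K , subst (y <_) (offset-suc K) y<)

  position-at : ∀ i x → x < size (toℕ i) → ∃ λ e → position e ≡ offset (toℕ i) + x
  position-at i x x< with edge-at-slot positions i _ (slot-bound i x x<)
  ... | e , pos≡ = e , trans pos≡ (cong (λ z → offset (toℕ i) + z) (transpose₀-involutive _ x))

  position-onto : ∀ y → y < Graph.m G → ∃ λ e → position e ≡ y
  position-onto y y< with locate p ℕP.≤-refl y (subst (y <_) edges-offset y<)
  ... | i , off≤y , y<end with position-at i (y ∸ offset (toℕ i))
                                 (ℕP.+-cancelˡ-< (offset (toℕ i)) _ _ (subst (_< offset (toℕ i) + size (toℕ i)) (sym (ℕP.m+[n∸m]≡n off≤y)) y<end))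
  ...   | e , pos≡ = e , trans pos≡ (ℕP.m+[n∸m]≡n off≤y)

  vsum-zero : ∀ u → 3 ≤ degree G u → vsum G orientation (label ∘ position) u ≡ 0ℤ
  vsum-zero cen        3≤deg = vsum-cen-zero (1≤half (subst (3 ≤_) degree-cen 3≤deg))
  vsum-zero (hub i)    _     = vsum-hub-zero i
  vsum-zero (leaf i k) 3≤deg with subst (3 ≤_) (degree-leaf i k) 3≤deg
  ... | s≤s ()

  labeled : ∀ {L} → LabelsExactly (Graph.m G) L → ZeroSumLabeling G L
  labeled labels = orientation , label ∘ position , isLabeling-label∘ G position position< position-onto labels , vsum-zero

  edges-even : 2 ∣ Graph.m G
  edges-even = subst (2 ∣_) (sym edges-offset) (offset-even p)

odd-form : ∀ {p} → ¬ 2 ∣ p → ∃ λ q → p ≡ suc (q * 2)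
odd-form {p} 2∤p with parityView p
... | even t = ⊥-elim (2∤p (divides t refl))
... | odd  t = t , refl

lemma28 : (p : ℕ) (n : Fin p → ℕ) → (∀ i → 3 ≤ n i) →
          (∀ (u : SV p n) → u ≢ cen → 2 ≤ degree (snowflake p n) u → 2 ∣ degree (snowflake p n) u) →
          ¬ (2 ∣ degree (snowflake p n) cen) →
          (4 ∣ Graph.m (snowflake p n) → Conservative (snowflake p n)) ×
          (¬ (4 ∣ Graph.m (snowflake p n)) → NearConservative (snowflake p n))
lemma28 p n n≥3 even-degrees odd-centre with odd-form (odd-centre ∘ subst (2 ∣_) (sym (SnowflakeStructure.degree-cen p n)))
... | q , refl = labeled ∘ labels-conservative , labeled ∘ labels-nearConservative (evenForm edges-even)
  where
  n-even : ∀ i → 2 ∣ n i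
  n-even i = subst (2 ∣_) deg≡n (even-degrees (hub i) (λ ()) (subst (2 ≤_) (sym deg≡n) (ℕP.≤-trans (ℕP.n≤1+n 2) (n≥3 i))))
    where deg≡n = SnowflakeStructure.degree-hub _ n i (ℕP.≤-trans (s≤s z≤n) (n≥3 i))
  open Construction q n n≥3 n-even
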